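{- For a finite abelian group $\mathcal{A}$, $$\Psi_{\mathcal{A}}(x)=\sum_{K\le\mathcal{A}}\mu(K)\left((1+x^2)^{\frac{|K|-|O_2(K)|-1}{2}}(1+x)^{|O_2(K)|}-1\right),$$ and hence $$\mathcal{E}(\mathcal{A})=\Psi_{\mathcal{A}}(1)=\sum_{K\le\mathcal{A}}\mu(K)\left(2^{\frac{|K|+|O_2(K)|-1}{2}}-1\right).$$
   Context: For a finite group $\mathcal{A}$ with identity $e$ and a generating set $\Omega$ with $\Omega=\Omega^{ -1}$, $e\notin\Omega$, the Cayley graph $C(\mathcal{A},\Omega)$ has vertex set $\mathcal{A}$ and edges $\{g,h\}$ with $g^{ -1}h\in\Omega$, with $\mathcal{A}$ acting by left multiplication. Two such Cayley graphs are equivalent if there is a graph isomorphism $f$ between them with $f(gu)=gf(u)$ for all $g\in\mathcal{A}$ and vertices $u$. $a_k(\mathcal{A})$ is the number of equivalence classes of Cayley graphs $C(\mathcal{A},\Omega)$ with $|\Omega|=k$, $\Psi_{\mathcal{A}}(x)=\sum_{k=1}^{|\mathcal{A}|-1}a_k(\mathcal{A})x^k$, and $\mathcal{E}(\mathcal{A})$ is the number of equivalence classes of such Cayley graphs. $K$ runs over subgroups of $\mathcal{A}$; $O_2(K)=\{g\in K: g^2=e,\ g\ne e\}$. The Möbius function $\mu$ on subgroups of $\mathcal{A}$ is defined recursively by $\sum_{H\ge K}\mu(H)=1$ if $K=\mathcal{A}$ and $0$ if $K<\mathcal{A}$ (sum over subgroups $H\supseteq K$). -}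

module Defs where

open import Data.Nat as ℕ using (ℕ; zero; suc; _≤_; _<_; _∸_)
open import Data.Integer as ℤ using (ℤ; +_)
open import Data.Bool using (Bool)
open import Data.Fin using (Fin; _≟_)
open import Data.Fin.Properties using (all?)
open import Data.Fin.Subset using (Subset; _∈_; _∉_; _⊆_; ∣_∣; inside; outside)
open import Data.Fin.Subset.Properties using (_∈?_; _⊆?_)
open import Data.List using (List; []; _∷_; _++_; map; filter; length; allFin; foldr)
open import Data.List.Relation.Unary.All using (All)
open import Data.List.Relation.Unary.Any using (Any)
open import Data.List.Relation.Unary.AllPairs using (AllPairs)
open import Data.Vec using (Vec; []; _∷_)
open import Data.Product using (Σ; _×_; _,_)
open import Data.Product.Relation.Binary.Pointwise.NonDependent using ()
open import Relation.Nullary using (¬_; Dec)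
open import Relation.Nullary.Decidable using (_×-dec_; _→-dec_; ¬?)
open import Relation.Binary.PropositionalEquality using (_≡_)
open import Algebra.Structures using (IsAbelianGroup)
open import Function.Bundles using (_⤖_; Bijection)

-- Finite abelian groups: a group law on the carrier Fin n
-- (every finite abelian group of order n is isomorphic to one of these).

record FinAbGroup (n : ℕ) : Set where
  infixl 7 _∙_
  infix 8 _⁻¹
  field
    _∙_ : Fin n → Fin n → Fin n
    ε : Fin n
    _⁻¹ : Fin n → Fin n
    isAbelianGroup : IsAbelianGroup _≡_ _∙_ ε _⁻¹

-- Integer polynomials as coefficient lists (constant term first).

Poly : Set
Poly = List ℤ

infixl 6 _+ₚ_
infixl 7 _*ₚ_

_+ₚ_ : Poly → Poly → Poly
[] +ₚ q = q
(a ∷ p) +ₚ [] = a ∷ p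
(a ∷ p) +ₚ (b ∷ q) = (a ℤ.+ b) ∷ (p +ₚ q)

scaleₚ : ℤ → Poly → Poly
scaleₚ c p = map (c ℤ.*_) p

_*ₚ_ : Poly → Poly → Poly
[] *ₚ q = []
(a ∷ p) *ₚ q = scaleₚ a q +ₚ (+ 0 ∷ (p *ₚ q))

oneₚ : Poly
oneₚ = + 1 ∷ []

powₚ : Poly → ℕ → Poly
powₚ p zero = oneₚ
powₚ p (suc k) = p *ₚ powₚ p k

coeff : Poly → ℕ → ℤ
coeff [] k = + 0
coeff (a ∷ p) zero = a
coeff (a ∷ p) (suc k) = coeff p k

1+x² : Poly
1+x² = + 1 ∷ + 0 ∷ + 1 ∷ []

1+x : Poly
1+x = + 1 ∷ + 1 ∷ []

sumℤ : List ℤ → ℤ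
sumℤ = foldr ℤ._+_ (+ 0)

sumₚ : List Poly → Poly
sumₚ = foldr _+ₚ_ []

allSubsets : (n : ℕ) → List (Subset n)
allSubsets zero = [] ∷ []
allSubsets (suc n) = map (inside ∷_) (allSubsets n) ++ map (outside ∷_) (allSubsets n)

module _ {n : ℕ} (G : FinAbGroup n) where
  open FinAbGroup G

  IsSubgroup : Subset n → Set
  IsSubgroup K = (ε ∈ K)
               × (∀ x y → x ∈ K → y ∈ K → (x ∙ y) ∈ K)
               × (∀ x → x ∈ K → (x ⁻¹) ∈ K)

  isSubgroup? : (K : Subset n) → Dec (IsSubgroup K)
  isSubgroup? K =
    (ε ∈? K)
    ×-dec all? (λ x → all? (λ y → (x ∈? K) →-dec ((y ∈? K) →-dec ((x ∙ y) ∈? K))))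
    ×-dec all? (λ x → (x ∈? K) →-dec ((x ⁻¹) ∈? K))

  subgroups : List (Subset n)
  subgroups = filter isSubgroup? (allSubsets n)

  O₂size : Subset n → ℕ
  O₂size K = length (filter (λ g → (g ∈? K) ×-dec ((g ∙ g) ≟ ε) ×-dec ¬? (g ≟ ε)) (allFin n))

  IsMöbius : (Subset n → ℤ) → Set
  IsMöbius μ = ∀ K → IsSubgroup K →
      ((∀ x → x ∈ K) → sumℤ (map μ (filter (K ⊆?_) subgroups)) ≡ + 1)
    × (¬ (∀ x → x ∈ K) → sumℤ (map μ (filter (K ⊆?_) subgroups)) ≡ + 0)

  Generates : Subset n → Set
  Generates Ω = ∀ K → IsSubgroup K → Ω ⊆ K → ∀ x → x ∈ K

  IsCayleySet : Subset n → Set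
  IsCayleySet Ω = (∀ x → x ∈ Ω → (x ⁻¹) ∈ Ω) × (ε ∉ Ω) × Generates Ω

  Adj : Subset n → Fin n → Fin n → Set
  Adj Ω g h = (g ⁻¹ ∙ h) ∈ Ω

  Equivalent : Subset n → Subset n → Set
  Equivalent Ω Ω' = Σ (Fin n ⤖ Fin n) λ f →
      let F = Bijection.to f in
      (∀ g h → (Adj Ω g h → Adj Ω' (F g) (F h)) × (Adj Ω' (F g) (F h) → Adj Ω g h))
    × (∀ g u → F (g ∙ u) ≡ g ∙ F u)

  NumClasses : (Subset n → Set) → ℕ → Set
  NumClasses P m = Σ (List (Subset n)) λ L →
      (length L ≡ m)
    × All P L
    × AllPairs (λ Ω Ω' → ¬ Equivalent Ω Ω') L
    × (∀ Ω → P Ω → Any (Equivalent Ω) L)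

  IsAk : ℕ → ℕ → Set
  IsAk k m = NumClasses (λ Ω → IsCayleySet Ω × ∣ Ω ∣ ≡ k) m

  IsE : ℕ → Set
  IsE m = NumClasses (λ Ω → IsCayleySet Ω × 1 ≤ ∣ Ω ∣) m

  ΨFormula : (Subset n → ℤ) → Poly
  ΨFormula μ = sumₚ (map (λ K → scaleₚ (μ K)
      (powₚ 1+x² ((∣ K ∣ ∸ O₂size K ∸ 1) ℕ./ 2) *ₚ powₚ 1+x (O₂size K)
        +ₚ scaleₚ (ℤ.- + 1) oneₚ)) subgroups)

  EFormula : (Subset n → ℤ) → ℤ
  EFormula μ = sumℤ (map (λ K → μ K ℤ.* (+ (2 ℕ.^ ((∣ K ∣ ℕ.+ O₂size K ∸ 1) ℕ./ 2)) ℤ.- + 1)) subgroups)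

module Submission where

-- An equivalence of Cayley graphs of an abelian group commutes with all translations, so it is
-- itself a translation and fixes the connection set: the classes are just the sets Ω ⊆ A ∖ {e}
-- that are closed under inversion and generate A. Möbius inversion on the subgroup lattice
-- replaces "Ω generates A" by Σ_{K ⊇ Ω} μ(K), which leaves, for each subgroup K, the inverse-closed
-- subsets of K ∖ {e}. Inversion splits K ∖ {e} into |O₂(K)| fixed points and (|K| − |O₂(K)| − 1)/2
-- two-element orbits, and an inverse-closed set is a union of orbits, so these subsets are counted
-- by size by (1 + x)^|O₂(K)| (1 + x²)^((|K| − |O₂(K)| − 1)/2); the −1 discards Ω = ∅, and x = 1
-- gives 𝓔(A).

open import Defs
open import Data.Nat using (ℕ; _≤_; _<_)
open import Data.Integer using (ℤ; +_)
open import Data.Fin.Subset using (Subset)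
open import Data.Product using (Σ; _×_)
open import Data.Sum using (_⊎_)
open import Relation.Binary.PropositionalEquality using (_≡_)

open import Level using (Level; 0ℓ)
open import Function using (_∘_; id; _⇔_; mk⇔; Equivalence)
open import Function.Bundles using (Bijection)
open import Function.Construct.Composition using (_⇔-∘_)
open import Function.Construct.Identity using (⇔-id; ⤖-id)
open import Data.Bool using (true; false; if_then_else_)
open import Data.Product using (_,_; proj₁; proj₂; uncurry)
open import Data.Product.Function.NonDependent.Propositional using (_×-⇔_)
open import Data.Sum using (inj₁; inj₂; [_,_]′)
import Data.Sum as Sum
open import Relation.Nullary using (contradiction; ¬_; Dec; yes; no; does; ¬?; _×-dec_; _→-dec_)
open import Relation.Nullary.Decidable using (does-⇔; dec-true; dec-false)
import Relation.Nullary.Decidable as Dec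
open import Relation.Unary using (Pred; Decidable)
open import Relation.Binary.PropositionalEquality
  using (refl; sym; trans; cong; cong₂; subst; _≢_; module ≡-Reasoning)
import Relation.Binary.Construct.On as On
open import Induction.WellFounded using (module All)

open import Data.Nat as ℕ using (zero; suc; _∸_)
import Data.Nat.Properties as ℕ
open import Data.Nat.DivMod using (m*n/n≡m)
open import Data.Nat.Induction using (<-wellFounded)
open import Data.Nat.Tactic.RingSolver using () renaming (solve-∀ to ℕ-solve-∀)
open import Data.Integer as ℤ using (_+_; _*_)
import Data.Integer.Properties as ℤ
open import Data.Integer.Tactic.RingSolver using (solve-∀)

open import Data.Fin using (Fin; _≟_) renaming (zero to fzero; suc to fsuc)
open import Data.Fin.Properties using (any?; all?)
open import Data.Fin.Subset
  using (_∈_; _∉_; _⊆_; ∣_∣; inside; outside; ⊥; ⁅_⁆; _∪_; _─_; _-_; ⋂; Nonempty)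
open import Data.Fin.Subset.Properties
  using (_∈?_; _⊆?_; Lift?; nonempty?; ∉⊥; ⊥⊆; ∈⊤; ⊆⊤; ⊆-antisym; Empty-unique;
         ∣⊥∣≡0; ∣⊤∣≡n; p⊂q⇒∣p∣<∣q∣; x∈p⇒∣p-x∣<∣p∣;
         x∈⁅x⁆; x∈⁅y⁆⇒x≡y; x∈p∩q⁺; x∈p∩q⁻; x∈p∪q⁺; x∈p∪q⁻; ∪-assoc; ∪-identityʳ;
         x∈p∧x≢y⇒x∈p-y; x∈p∧x∉q⇒x∈p─q; p─q⊆p; p─⊥≡p; p─q─r≡p─q∪r)
open import Data.Vec using (_∷_; []; here; there; tabulate)
open import Data.Vec.Properties
  using (∷-injectiveʳ; lookup⇒[]=; []=⇒lookup; lookup∘tabulate; tabulate-cong)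
open import Data.List using (List; []; _∷_; _++_; map; filter; length)
import Data.List as List
import Data.List.Properties as List
open import Data.List.Relation.Unary.All using (All; []; _∷_)
import Data.List.Relation.Unary.All as All
import Data.List.Relation.Unary.All.Properties as All
open import Data.List.Relation.Unary.Any using (here; there)
import Data.List.Relation.Unary.Any as Any
open import Data.List.Relation.Unary.AllPairs using (AllPairs; []; _∷_)
import Data.List.Relation.Unary.AllPairs as AllPairs
import Data.List.Relation.Unary.AllPairs.Properties as AllPairs
open import Data.List.Membership.Propositional using () renaming (_∈_ to _∈ₗ_)
open import Data.List.Membership.Propositional.Properties using (∈-++⁺ˡ; ∈-++⁺ʳ; ∈-map⁺; ∈-filter⁺)

open import Algebra.Structures using (IsAbelianGroup)
open import Algebra.Bundles using (Group)
import Algebra.Properties.Group as GroupProperties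

private
  variable
    n : ℕ
    I : Set
    ℓ ℓ′ : Level
    P : Set ℓ
    Q : Set ℓ′

infixl 7.5 _when_
_when_ : ℤ → Dec P → ℤ
v when P? = if does P? then v else + 0

when-⇔ : ∀ v (P? : Dec P) (Q? : Dec Q) → P ⇔ Q → v when P? ≡ v when Q?
when-⇔ v P? Q? P⇔Q = cong (if_then v else + 0) (does-⇔ P⇔Q P? Q?)

when-yes : ∀ v (P? : Dec P) → P → v when P? ≡ v
when-yes v P? p rewrite dec-true P? p = refl

when-no : ∀ v (P? : Dec P) → ¬ P → v when P? ≡ + 0
when-no v P? ¬p rewrite dec-false P? ¬p = refl

when-vanishes : ∀ v (P? : Dec P) → (P → v ≡ + 0) → v when P? ≡ + 0
when-vanishes v (yes p) v≡0 = v≡0 p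
when-vanishes v (no _) _ = refl

when-×-dec : ∀ v (P? : Dec P) (Q? : Dec Q) → v when (P? ×-dec Q?) ≡ (v when Q?) when P?
when-×-dec v P? Q? with does P?
... | true = refl
... | false = refl

when-+ : ∀ u v (P? : Dec P) → (u + v) when P? ≡ u when P? + v when P?
when-+ u v P? with does P?
... | true = refl
... | false = refl

when-0 : ∀ (P? : Dec P) → + 0 when P? ≡ + 0
when-0 P? = when-vanishes (+ 0) P? (λ _ → refl)

when-as-* : ∀ v (P? : Dec P) → v when P? ≡ v * (+ 1 when P?)
when-as-* v P? with does P?
... | true = sym (ℤ.*-identityʳ v)
... | false = sym (ℤ.*-zeroʳ v)

*-when-swap : ∀ u v (P? : Dec P) → u * (v when P?) ≡ v * (u when P?)
*-when-swap u v P? with does P?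
... | true = ℤ.*-comm u v
... | false = trans (ℤ.*-zeroʳ u) (sym (ℤ.*-zeroʳ v))

sum-++ : ∀ (xs ys : List ℤ) → sumℤ (xs ++ ys) ≡ sumℤ xs + sumℤ ys
sum-++ [] ys = sym (ℤ.+-identityˡ _)
sum-++ (x ∷ xs) ys = trans (cong (_+_ x) (sum-++ xs ys)) (sym (ℤ.+-assoc x _ _))

sum-map-cong : ∀ {P : Pred I 0ℓ} {f g : I → ℤ} {xs} →
               (∀ {x} → P x → f x ≡ g x) → All P xs → sumℤ (map f xs) ≡ sumℤ (map g xs)
sum-map-cong f≡g [] = refl
sum-map-cong f≡g (px ∷ pxs) = cong₂ _+_ (f≡g px) (sum-map-cong f≡g pxs)

sum-map-+ : ∀ (f g : I → ℤ) xs →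
            sumℤ (map (λ x → f x + g x) xs) ≡ sumℤ (map f xs) + sumℤ (map g xs)
sum-map-+ f g [] = refl
sum-map-+ f g (x ∷ xs) = trans (cong (_+_ (f x + g x)) (sum-map-+ f g xs)) (interchange (f x) (g x) _ _)
  where
  interchange : ∀ a b c d → (a + b) + (c + d) ≡ (a + c) + (b + d)
  interchange = solve-∀

sum-map-*ˡ : ∀ c (f : I → ℤ) xs → sumℤ (map (λ x → c * f x) xs) ≡ c * sumℤ (map f xs)
sum-map-*ˡ c f [] = sym (ℤ.*-zeroʳ c)
sum-map-*ˡ c f (x ∷ xs) = trans (cong (_+_ (c * f x)) (sum-map-*ˡ c f xs)) (sym (ℤ.*-distribˡ-+ c _ _))

sum-map-0 : ∀ (xs : List I) → sumℤ (map (λ _ → + 0) xs) ≡ + 0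
sum-map-0 [] = refl
sum-map-0 (x ∷ xs) = trans (ℤ.+-identityˡ _) (sum-map-0 xs)

sum-map-swap : ∀ {B : Set} (f : I → B → ℤ) xs ys →
               sumℤ (map (λ x → sumℤ (map (f x) ys)) xs) ≡
               sumℤ (map (λ y → sumℤ (map (λ x → f x y) xs)) ys)
sum-map-swap f [] ys = sym (sum-map-0 ys)
sum-map-swap f (x ∷ xs) ys =
  trans (cong (_+_ (sumℤ (map (f x) ys))) (sum-map-swap f xs ys))
        (sym (sum-map-+ (f x) (λ y → sumℤ (map (λ x → f x y) xs)) ys))

sum-map-when : ∀ {P : Pred I 0ℓ} (P? : Decidable P) (f : I → ℤ) xs →
               sumℤ (map (λ x → f x when P? x) xs) ≡ sumℤ (map f (filter P? xs))
sum-map-when P? f [] = refl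
sum-map-when P? f (x ∷ xs) with does (P? x)
... | true = cong (_+_ (f x)) (sum-map-when P? f xs)
... | false = trans (ℤ.+-identityˡ _) (sum-map-when P? f xs)

length-filter≡sum : ∀ {P : Pred I 0ℓ} (P? : Decidable P) xs →
                    + length (filter P? xs) ≡ sumℤ (map (λ x → + 1 when P? x) xs)
length-filter≡sum P? [] = refl
length-filter≡sum P? (x ∷ xs) with does (P? x)
... | true = cong (_+_ (+ 1)) (length-filter≡sum P? xs)
... | false = trans (length-filter≡sum P? xs) (sym (ℤ.+-identityˡ _))

x∈p─q⇒x∉q : ∀ {x} {p q : Subset n} → x ∈ p ─ q → x ∉ q
x∈p─q⇒x∉q {p = _ ∷ _} {outside ∷ _} here ()
x∈p─q⇒x∉q {p = _ ∷ _} {_ ∷ _} (there x∈p─q) (there x∈q) = x∈p─q⇒x∉q x∈p─q x∈q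

x∈p-y⇒x≢y : ∀ {x y} {p : Subset n} → x ∈ p - y → x ≢ y
x∈p-y⇒x≢y {y = y} x∈p-y refl = x∈p─q⇒x∉q x∈p-y (x∈⁅x⁆ y)

x∈p∪⁅y⁆⁻ : ∀ {x y} (p : Subset n) → x ∈ p ∪ ⁅ y ⁆ → x ∈ p ⊎ x ≡ y
x∈p∪⁅y⁆⁻ {y = y} p x∈ = Sum.map₂ (x∈⁅y⁆⇒x≡y y) (x∈p∪q⁻ p ⁅ y ⁆ x∈)

x∉p-x : ∀ {x} {p : Subset n} → x ∉ p - x
x∉p-x x∈p-x = x∈p-y⇒x≢y x∈p-x refl

⁅x⁆⊆p : ∀ {x} {p : Subset n} → x ∈ p → ⁅ x ⁆ ⊆ p
⁅x⁆⊆p {x = x} {p} x∈p y∈⁅x⁆ = subst (_∈ p) (sym (x∈⁅y⁆⇒x≡y x y∈⁅x⁆)) x∈p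

Disjoint : Subset n → Subset n → Set
Disjoint p q = ∀ {x} → x ∈ p → x ∉ q

⁅x⁆#p : ∀ {x} {p : Subset n} → x ∉ p → Disjoint ⁅ x ⁆ p
⁅x⁆#p {x = x} {p} x∉p y∈⁅x⁆ = subst (_∉ p) (sym (x∈⁅y⁆⇒x≡y x y∈⁅x⁆)) x∉p

⊆⇔⊆─ : ∀ {o p q : Subset n} → Disjoint o p → p ⊆ q ⇔ p ⊆ q ─ o
⊆⇔⊆─ {o = o} {q = q} o#p =
  mk⇔ (λ p⊆q {x} x∈p → x∈p∧x∉q⇒x∈p─q (p⊆q x∈p) (λ x∈o → o#p x∈o x∈p))
      (λ p⊆q─o {x} x∈p → p─q⊆p q o (p⊆q─o x∈p))

∣p∣≡1+∣p-x∣ : ∀ {x} {p : Subset n} → x ∈ p → ∣ p ∣ ≡ suc ∣ p - x ∣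
∣p∣≡1+∣p-x∣ {p = inside ∷ p} here = cong (suc ∘ ∣_∣) (sym (p─⊥≡p p))
∣p∣≡1+∣p-x∣ {p = inside ∷ p} (there x∈p) = cong suc (∣p∣≡1+∣p-x∣ x∈p)
∣p∣≡1+∣p-x∣ {p = outside ∷ p} (there x∈p) = ∣p∣≡1+∣p-x∣ x∈p

∣p∪⁅x⁆∣≡1+∣p∣ : ∀ {x} {p : Subset n} → x ∉ p → ∣ p ∪ ⁅ x ⁆ ∣ ≡ suc ∣ p ∣
∣p∪⁅x⁆∣≡1+∣p∣ {x = fzero} {inside ∷ p} x∉p = contradiction here x∉p
∣p∪⁅x⁆∣≡1+∣p∣ {x = fzero} {outside ∷ p} x∉p = cong (suc ∘ ∣_∣) (∪-identityʳ p)
∣p∪⁅x⁆∣≡1+∣p∣ {x = fsuc x} {inside ∷ p} x∉p = cong suc (∣p∪⁅x⁆∣≡1+∣p∣ (x∉p ∘ there))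
∣p∪⁅x⁆∣≡1+∣p∣ {x = fsuc x} {outside ∷ p} x∉p = ∣p∪⁅x⁆∣≡1+∣p∣ (x∉p ∘ there)

⟦_⟧ : {P : Pred (Fin n) 0ℓ} → Decidable P → Subset n
⟦ P? ⟧ = tabulate (does ∘ P?)

module _ {P : Pred (Fin n) 0ℓ} (P? : Decidable P) where

  ∈⟦⟧⁺ : ∀ {x} → P x → x ∈ ⟦ P? ⟧
  ∈⟦⟧⁺ {x} px =
    lookup⇒[]= x ⟦ P? ⟧ (trans (lookup∘tabulate (does ∘ P?) x) (dec-true (P? x) px))

  ∈⟦⟧⁻ : ∀ {x} → x ∈ ⟦ P? ⟧ → P x
  ∈⟦⟧⁻ {x} x∈ = witness (P? x) (trans (sym (lookup∘tabulate (does ∘ P?) x)) ([]=⇒lookup x∈))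
    where
    witness : (d : Dec (P x)) → does d ≡ true → P x
    witness (yes px) _ = px

  ⟦⟧-cong : {Q : Pred (Fin n) 0ℓ} (Q? : Decidable Q) → (∀ x → P x ⇔ Q x) → ⟦ P? ⟧ ≡ ⟦ Q? ⟧
  ⟦⟧-cong Q? P⇔Q = tabulate-cong (λ x → does-⇔ (P⇔Q x) (P? x) (Q? x))

length-filter-tabulate : ∀ {P : Pred I 0ℓ} (P? : Decidable P) (f : Fin n → I) →
                         length (filter P? (List.tabulate f)) ≡ ∣ tabulate (does ∘ P? ∘ f) ∣
length-filter-tabulate {n = zero} P? f = refl
length-filter-tabulate {n = suc n} P? f with does (P? (f fzero))
... | true = cong suc (length-filter-tabulate P? (f ∘ fsuc))
... | false = length-filter-tabulate P? (f ∘ fsuc)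

∈-allSubsets : ∀ (Ω : Subset n) → Ω ∈ₗ allSubsets n
∈-allSubsets [] = here refl
∈-allSubsets {suc n} (inside ∷ Ω) = ∈-++⁺ˡ (∈-map⁺ (inside ∷_) (∈-allSubsets Ω))
∈-allSubsets {suc n} (outside ∷ Ω) =
  ∈-++⁺ʳ (map (inside ∷_) (allSubsets n)) (∈-map⁺ (outside ∷_) (∈-allSubsets Ω))

allSubsets-unique : ∀ n → AllPairs _≢_ (allSubsets n)
allSubsets-unique zero = [] ∷ []
allSubsets-unique (suc n) =
  AllPairs.++⁺ (AllPairs.map⁺ (tails-differ (allSubsets-unique n)))
               (AllPairs.map⁺ (tails-differ (allSubsets-unique n)))
               (All.map⁺ (All.universal (λ _ → All.map⁺ (All.universal (λ _ ()) Ωs)) Ωs))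
  where
  Ωs = allSubsets n
  tails-differ : ∀ {s} {xs : List (Subset n)} → AllPairs _≢_ xs → AllPairs (λ Ω Ω′ → s ∷ Ω ≢ s ∷ Ω′) xs
  tails-differ = AllPairs.map (λ Ω≢Ω′ → Ω≢Ω′ ∘ ∷-injectiveʳ)

∑ : (Subset n → ℤ) → ℤ
∑ {n} f = sumℤ (map f (allSubsets n))

∑-cong : {f g : Subset n → ℤ} → (∀ Ω → f Ω ≡ g Ω) → ∑ f ≡ ∑ g
∑-cong {n} f≗g = cong sumℤ (List.map-cong f≗g (allSubsets n))

∑-0 : {f : Subset n → ℤ} → (∀ Ω → f Ω ≡ + 0) → ∑ f ≡ + 0
∑-0 {n} f≗0 = trans (∑-cong {g = λ _ → + 0} f≗0) (sum-map-0 (allSubsets n))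

∑-∷ : (f : Subset (suc n) → ℤ) → ∑ f ≡ ∑ (λ Ω → f (inside ∷ Ω)) + ∑ (λ Ω → f (outside ∷ Ω))
∑-∷ {n} f = begin
  sumℤ (map f (map (inside ∷_) Ωs ++ map (outside ∷_) Ωs))
    ≡⟨ cong sumℤ (List.map-++ f (map (inside ∷_) Ωs) _) ⟩
  sumℤ (map f (map (inside ∷_) Ωs) ++ map f (map (outside ∷_) Ωs))
    ≡⟨ sum-++ (map f (map (inside ∷_) Ωs)) _ ⟩
  sumℤ (map f (map (inside ∷_) Ωs)) + sumℤ (map f (map (outside ∷_) Ωs))
    ≡⟨ cong₂ _+_ (cong sumℤ (sym (List.map-∘ Ωs))) (cong sumℤ (sym (List.map-∘ Ωs))) ⟩
  ∑ (λ Ω → f (inside ∷ Ω)) + ∑ (λ Ω → f (outside ∷ Ω)) ∎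
  where
  open ≡-Reasoning
  Ωs = allSubsets n

∑-insert : ∀ (g : Fin n) (f : Subset n → ℤ) →
           ∑ f ≡ ∑ (λ Ω → (f Ω + f (Ω ∪ ⁅ g ⁆)) when ¬? (g ∈? Ω))
∑-insert {suc n} fzero f = begin
  ∑ f
    ≡⟨ ∑-∷ f ⟩
  ∑ (λ Ω → f (inside ∷ Ω)) + ∑ (λ Ω → f (outside ∷ Ω))
    ≡⟨ ℤ.+-comm (∑ (λ Ω → f (inside ∷ Ω))) _ ⟩
  ∑ (λ Ω → f (outside ∷ Ω)) + ∑ (λ Ω → f (inside ∷ Ω))
    ≡⟨ sum-map-+ (λ Ω → f (outside ∷ Ω)) _ (allSubsets n) ⟨
  ∑ (λ Ω → f (outside ∷ Ω) + f (inside ∷ Ω))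
    ≡⟨ ∑-cong (λ Ω → cong (λ Ω′ → f (outside ∷ Ω) + f (inside ∷ Ω′)) (∪-identityʳ Ω)) ⟨
  ∑ (λ Ω → f (outside ∷ Ω) + f (inside ∷ (Ω ∪ ⊥)))
    ≡⟨ trans (cong₂ _+_ (sum-map-0 (allSubsets n)) refl) (ℤ.+-identityˡ _) ⟨
  ∑ {n} (λ _ → + 0) + ∑ (λ Ω → f (outside ∷ Ω) + f (inside ∷ (Ω ∪ ⊥)))
    ≡⟨ ∑-∷ (λ Ω → (f Ω + f (Ω ∪ ⁅ fzero ⁆)) when ¬? (fzero ∈? Ω)) ⟨
  ∑ (λ Ω → (f Ω + f (Ω ∪ ⁅ fzero ⁆)) when ¬? (fzero ∈? Ω)) ∎
  where open ≡-Reasoning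
∑-insert {suc n} (fsuc g) f = begin
  ∑ f
    ≡⟨ ∑-∷ f ⟩
  ∑ (λ Ω → f (inside ∷ Ω)) + ∑ (λ Ω → f (outside ∷ Ω))
    ≡⟨ cong₂ _+_ (∑-insert g (λ Ω → f (inside ∷ Ω))) (∑-insert g (λ Ω → f (outside ∷ Ω))) ⟩
  ∑ (λ Ω → (f (inside ∷ Ω) + f (inside ∷ Ω ∪ ⁅ g ⁆)) when ¬? (g ∈? Ω))
    + ∑ (λ Ω → (f (outside ∷ Ω) + f (outside ∷ Ω ∪ ⁅ g ⁆)) when ¬? (g ∈? Ω))
    ≡⟨ ∑-∷ (λ Ω → (f Ω + f (Ω ∪ ⁅ fsuc g ⁆)) when ¬? (fsuc g ∈? Ω)) ⟨
  ∑ (λ Ω → (f Ω + f (Ω ∪ ⁅ fsuc g ⁆)) when ¬? (fsuc g ∈? Ω)) ∎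
  where open ≡-Reasoning

∑-only-⊥ : {f : Subset n → ℤ} → (∀ Ω → Nonempty Ω → f Ω ≡ + 0) → ∑ f ≡ f ⊥
∑-only-⊥ {zero} f≡0 = ℤ.+-identityʳ _
∑-only-⊥ {suc n} {f} f≡0 = begin
  ∑ f
    ≡⟨ ∑-∷ f ⟩
  ∑ (λ Ω → f (inside ∷ Ω)) + ∑ (λ Ω → f (outside ∷ Ω))
    ≡⟨ cong₂ _+_ (∑-0 (λ Ω → f≡0 (inside ∷ Ω) (fzero , here)))
                 (∑-only-⊥ (λ Ω (x , x∈Ω) → f≡0 (outside ∷ Ω) (fsuc x , there x∈Ω))) ⟩
  + 0 + f ⊥
    ≡⟨ ℤ.+-identityˡ _ ⟩
  f ⊥ ∎
  where open ≡-Reasoning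

-- Polynomials up to equality of coefficients

infix 4 _≈ₚ_
_≈ₚ_ : Poly → Poly → Set
p ≈ₚ q = ∀ k → coeff p k ≡ coeff q k

coeff-+ₚ : ∀ p q k → coeff (p +ₚ q) k ≡ coeff p k + coeff q k
coeff-+ₚ [] q k = sym (ℤ.+-identityˡ _)
coeff-+ₚ (a ∷ p) [] zero = sym (ℤ.+-identityʳ a)
coeff-+ₚ (a ∷ p) [] (suc k) = sym (ℤ.+-identityʳ _)
coeff-+ₚ (a ∷ p) (b ∷ q) zero = refl
coeff-+ₚ (a ∷ p) (b ∷ q) (suc k) = coeff-+ₚ p q k

coeff-scaleₚ : ∀ c p k → coeff (scaleₚ c p) k ≡ c * coeff p k
coeff-scaleₚ c [] k = sym (ℤ.*-zeroʳ c)
coeff-scaleₚ c (a ∷ p) zero = refl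
coeff-scaleₚ c (a ∷ p) (suc k) = coeff-scaleₚ c p k

coeff-sumₚ : ∀ (F : I → Poly) xs k →
             coeff (sumₚ (map F xs)) k ≡ sumℤ (map (λ x → coeff (F x) k) xs)
coeff-sumₚ F [] k = refl
coeff-sumₚ F (x ∷ xs) k = trans (coeff-+ₚ (F x) _ k) (cong (_+_ (coeff (F x) k)) (coeff-sumₚ F xs k))

∷-congₚ : ∀ a {p q} → p ≈ₚ q → a ∷ p ≈ₚ a ∷ q
∷-congₚ a p≈q zero = refl
∷-congₚ a p≈q (suc k) = p≈q k

coeff-∷*ₚ : ∀ a p q k → coeff ((a ∷ p) *ₚ q) k ≡ a * coeff q k + coeff (+ 0 ∷ p *ₚ q) k
coeff-∷*ₚ a p q k = trans (coeff-+ₚ (scaleₚ a q) _ k) (cong (_+ _) (coeff-scaleₚ a q k))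

*ₚ-congˡ : ∀ p {q r} → q ≈ₚ r → p *ₚ q ≈ₚ p *ₚ r
*ₚ-congˡ [] q≈r k = refl
*ₚ-congˡ (a ∷ p) {q} {r} q≈r k = begin
  coeff ((a ∷ p) *ₚ q) k
    ≡⟨ coeff-∷*ₚ a p q k ⟩
  a * coeff q k + coeff (+ 0 ∷ p *ₚ q) k
    ≡⟨ cong₂ _+_ (cong (a *_) (q≈r k)) (∷-congₚ (+ 0) (*ₚ-congˡ p q≈r) k) ⟩
  a * coeff r k + coeff (+ 0 ∷ p *ₚ r) k
    ≡⟨ coeff-∷*ₚ a p r k ⟨
  coeff ((a ∷ p) *ₚ r) k ∎
  where open ≡-Reasoning

*ₚ-identityˡ : ∀ p → oneₚ *ₚ p ≈ₚ p
*ₚ-identityˡ p zero = trans (coeff-∷*ₚ (+ 1) [] p zero) (trans (ℤ.+-identityʳ _) (ℤ.*-identityˡ _))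
*ₚ-identityˡ p (suc k) = trans (coeff-∷*ₚ (+ 1) [] p (suc k)) (trans (ℤ.+-identityʳ _) (ℤ.*-identityˡ _))

*ₚ-identityʳ : ∀ p → p *ₚ oneₚ ≈ₚ p
*ₚ-identityʳ [] k = refl
*ₚ-identityʳ (a ∷ p) zero = trans (ℤ.+-identityʳ _) (ℤ.*-identityʳ a)
*ₚ-identityʳ (a ∷ p) (suc k) = *ₚ-identityʳ p k

*ₚ-distribˡ-+ₚ : ∀ p q r → p *ₚ (q +ₚ r) ≈ₚ p *ₚ q +ₚ p *ₚ r
*ₚ-distribˡ-+ₚ [] q r k = refl
*ₚ-distribˡ-+ₚ (a ∷ p) q r k = begin
  coeff ((a ∷ p) *ₚ (q +ₚ r)) k
    ≡⟨ coeff-∷*ₚ a p (q +ₚ r) k ⟩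
  a * coeff (q +ₚ r) k + coeff (+ 0 ∷ p *ₚ (q +ₚ r)) k
    ≡⟨ cong₂ _+_ (cong (a *_) (coeff-+ₚ q r k)) (∷-congₚ (+ 0) (*ₚ-distribˡ-+ₚ p q r) k) ⟩
  a * (coeff q k + coeff r k) + coeff (+ 0 ∷ p *ₚ q +ₚ p *ₚ r) k
    ≡⟨ cong (_+_ (a * (coeff q k + coeff r k))) (shift-+ₚ k) ⟩
  a * (coeff q k + coeff r k) + (coeff (+ 0 ∷ p *ₚ q) k + coeff (+ 0 ∷ p *ₚ r) k)
    ≡⟨ regroup a (coeff q k) (coeff r k) _ _ ⟩
  (a * coeff q k + coeff (+ 0 ∷ p *ₚ q) k) + (a * coeff r k + coeff (+ 0 ∷ p *ₚ r) k)
    ≡⟨ cong₂ _+_ (coeff-∷*ₚ a p q k) (coeff-∷*ₚ a p r k) ⟨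
  coeff ((a ∷ p) *ₚ q) k + coeff ((a ∷ p) *ₚ r) k
    ≡⟨ coeff-+ₚ ((a ∷ p) *ₚ q) _ k ⟨
  coeff ((a ∷ p) *ₚ q +ₚ (a ∷ p) *ₚ r) k ∎
  where
  open ≡-Reasoning
  regroup : ∀ a x y u v → a * (x + y) + (u + v) ≡ (a * x + u) + (a * y + v)
  regroup = solve-∀
  shift-+ₚ : ∀ k → coeff (+ 0 ∷ p *ₚ q +ₚ p *ₚ r) k ≡
                   coeff (+ 0 ∷ p *ₚ q) k + coeff (+ 0 ∷ p *ₚ r) k
  shift-+ₚ zero = refl
  shift-+ₚ (suc k) = coeff-+ₚ (p *ₚ q) (p *ₚ r) k

*ₚ-shiftˡ : ∀ p q → (+ 0 ∷ p) *ₚ q ≈ₚ + 0 ∷ p *ₚ q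
*ₚ-shiftˡ p q k = trans (coeff-∷*ₚ (+ 0) p q k) (ℤ.+-identityˡ _)

*ₚ-shiftʳ : ∀ p q → p *ₚ (+ 0 ∷ q) ≈ₚ + 0 ∷ p *ₚ q
*ₚ-shiftʳ [] q zero = refl
*ₚ-shiftʳ [] q (suc k) = refl
*ₚ-shiftʳ (a ∷ p) q zero = trans (ℤ.+-identityʳ _) (ℤ.*-zeroʳ a)
*ₚ-shiftʳ (a ∷ p) q (suc k) = begin
  coeff (scaleₚ a q +ₚ p *ₚ (+ 0 ∷ q)) k
    ≡⟨ coeff-+ₚ (scaleₚ a q) _ k ⟩
  coeff (scaleₚ a q) k + coeff (p *ₚ (+ 0 ∷ q)) k
    ≡⟨ cong (_+_ (coeff (scaleₚ a q) k)) (*ₚ-shiftʳ p q k) ⟩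
  coeff (scaleₚ a q) k + coeff (+ 0 ∷ p *ₚ q) k
    ≡⟨ coeff-+ₚ (scaleₚ a q) _ k ⟨
  coeff ((a ∷ p) *ₚ q) k ∎
  where open ≡-Reasoning

1+x*ₚ : ∀ q → 1+x *ₚ q ≈ₚ q +ₚ (+ 0 ∷ q)
1+x*ₚ q k = begin
  coeff (1+x *ₚ q) k
    ≡⟨ coeff-∷*ₚ (+ 1) oneₚ q k ⟩
  + 1 * coeff q k + coeff (+ 0 ∷ oneₚ *ₚ q) k
    ≡⟨ cong₂ _+_ (ℤ.*-identityˡ (coeff q k)) (∷-congₚ (+ 0) {oneₚ *ₚ q} (*ₚ-identityˡ q) k) ⟩
  coeff q k + coeff (+ 0 ∷ q) k
    ≡⟨ coeff-+ₚ q _ k ⟨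
  coeff (q +ₚ (+ 0 ∷ q)) k ∎
  where open ≡-Reasoning

1+x²*ₚ : ∀ q → 1+x² *ₚ q ≈ₚ q +ₚ (+ 0 ∷ + 0 ∷ q)
1+x²*ₚ q k = begin
  coeff (1+x² *ₚ q) k
    ≡⟨ coeff-∷*ₚ (+ 1) (+ 0 ∷ oneₚ) q k ⟩
  + 1 * coeff q k + coeff (+ 0 ∷ (+ 0 ∷ oneₚ) *ₚ q) k
    ≡⟨ cong₂ _+_ (ℤ.*-identityˡ (coeff q k)) (∷-congₚ (+ 0) {(+ 0 ∷ oneₚ) *ₚ q} x*ₚq k) ⟩
  coeff q k + coeff (+ 0 ∷ + 0 ∷ q) k
    ≡⟨ coeff-+ₚ q _ k ⟨
  coeff (q +ₚ (+ 0 ∷ + 0 ∷ q)) k ∎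
  where
  open ≡-Reasoning
  x*ₚq : (+ 0 ∷ oneₚ) *ₚ q ≈ₚ + 0 ∷ q
  x*ₚq j = trans (*ₚ-shiftˡ oneₚ q j) (∷-congₚ (+ 0) (*ₚ-identityˡ q) j)

-- The generating polynomial, by size, of the subsets closed under an involution
-- with a two-element orbits and b fixed points.
orbitPoly : ℕ → ℕ → Poly
orbitPoly a b = powₚ 1+x² a *ₚ powₚ 1+x b

orbitPoly-fixed : ∀ a b → orbitPoly a (suc b) ≈ₚ orbitPoly a b +ₚ (+ 0 ∷ orbitPoly a b)
orbitPoly-fixed a b k = begin
  coeff (A *ₚ (1+x *ₚ B)) k                    ≡⟨ *ₚ-congˡ A (1+x*ₚ B) k ⟩
  coeff (A *ₚ (B +ₚ (+ 0 ∷ B))) k              ≡⟨ *ₚ-distribˡ-+ₚ A B (+ 0 ∷ B) k ⟩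
  coeff (A *ₚ B +ₚ A *ₚ (+ 0 ∷ B)) k           ≡⟨ coeff-+ₚ (A *ₚ B) _ k ⟩
  coeff (A *ₚ B) k + coeff (A *ₚ (+ 0 ∷ B)) k  ≡⟨ cong (_+_ (coeff (A *ₚ B) k)) (*ₚ-shiftʳ A B k) ⟩
  coeff (A *ₚ B) k + coeff (+ 0 ∷ A *ₚ B) k    ≡⟨ coeff-+ₚ (A *ₚ B) _ k ⟨
  coeff (A *ₚ B +ₚ (+ 0 ∷ A *ₚ B)) k           ∎
  where
  open ≡-Reasoning
  A = powₚ 1+x² a
  B = powₚ 1+x b

orbitPoly-pair : ∀ a → orbitPoly (suc a) 0 ≈ₚ orbitPoly a 0 +ₚ (+ 0 ∷ + 0 ∷ orbitPoly a 0)
orbitPoly-pair a k = begin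
  coeff ((1+x² *ₚ A) *ₚ oneₚ) k
    ≡⟨ *ₚ-identityʳ (1+x² *ₚ A) k ⟩
  coeff (1+x² *ₚ A) k
    ≡⟨ 1+x²*ₚ A k ⟩
  coeff (A +ₚ (+ 0 ∷ + 0 ∷ A)) k
    ≡⟨ coeff-+ₚ A _ k ⟩
  coeff A k + coeff (+ 0 ∷ + 0 ∷ A) k
    ≡⟨ cong₂ _+_ (*ₚ-identityʳ A k) (∷-congₚ (+ 0) (∷-congₚ (+ 0) (*ₚ-identityʳ A)) k) ⟨
  coeff (A *ₚ oneₚ) k + coeff (+ 0 ∷ + 0 ∷ A *ₚ oneₚ) k
    ≡⟨ coeff-+ₚ (A *ₚ oneₚ) _ k ⟨
  coeff (A *ₚ oneₚ +ₚ (+ 0 ∷ + 0 ∷ A *ₚ oneₚ)) k ∎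
  where
  open ≡-Reasoning
  A = powₚ 1+x² a

-- Subsets closed under an involution ι, counted by size

δ : ℕ → ℕ → ℤ
δ k j = + 1 when (j ℕ.≟ k)

δ≥1 : ℕ → ℤ
δ≥1 j = + 1 when (1 ℕ.≤? j)

module ClosedSubsets {n : ℕ} (ι : Fin n → Fin n) (ι-involutive : ∀ x → ι (ι x) ≡ x) where

  private
    variable
      x g : Fin n
      o S Ω : Subset n

  Closed : Pred (Subset n) 0ℓ
  Closed Ω = ∀ {x} → x ∈ Ω → ι x ∈ Ω

  closed? : Decidable Closed
  closed? Ω = Lift? (λ x → ι x ∈? Ω) Ω

  ClosedIn : Subset n → Pred (Subset n) 0ℓ
  ClosedIn S Ω = Ω ⊆ S × Closed Ω

  closedIn? : ∀ S → Decidable (ClosedIn S)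
  closedIn? S Ω = Ω ⊆? S ×-dec closed? Ω

  closedCount : (ℕ → ℤ) → Subset n → ℤ
  closedCount w S = ∑ λ Ω → w ∣ Ω ∣ when closedIn? S Ω

  fixedCount : Subset n → ℕ
  fixedCount S = ∣ ⟦ (λ x → x ∈? S ×-dec ι x ≟ x) ⟧ ∣

  orbit : Fin n → Subset n
  orbit g = ⁅ ι g ⁆ ∪ ⁅ g ⁆

  closed-⁅⁆ : ι g ≡ g → Closed ⁅ g ⁆
  closed-⁅⁆ {g = g} ιg≡g x∈⁅g⁆ rewrite x∈⁅y⁆⇒x≡y g x∈⁅g⁆ | ιg≡g = x∈⁅x⁆ g

  closed-orbit : ∀ g → Closed (orbit g)
  closed-orbit g x∈ with x∈p∪⁅y⁆⁻ ⁅ ι g ⁆ x∈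
  ... | inj₁ x∈⁅ιg⁆ rewrite x∈⁅y⁆⇒x≡y (ι g) x∈⁅ιg⁆ | ι-involutive g = x∈p∪q⁺ (inj₂ (x∈⁅x⁆ g))
  ... | inj₂ refl = x∈p∪q⁺ (inj₁ (x∈⁅x⁆ (ι g)))

  closed-─ : Closed S → Closed o → Closed (S ─ o)
  closed-─ {S = S} {o = o} clS clo {x} x∈ =
    x∈p∧x∉q⇒x∈p─q (clS (p─q⊆p S o x∈))
                  (λ ιx∈o → x∈p─q⇒x∉q x∈ (subst (_∈ o) (ι-involutive x) (clo ιx∈o)))

  closed-∪⇔ : Closed o → Disjoint o Ω → Closed (Ω ∪ o) ⇔ Closed Ω
  closed-∪⇔ {o = o} {Ω = Ω} clo o#Ω = mk⇔ to from
    where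
    to : Closed (Ω ∪ o) → Closed Ω
    to cl {x} x∈Ω with x∈p∪q⁻ Ω o (cl (x∈p∪q⁺ (inj₁ x∈Ω)))
    ... | inj₁ ιx∈Ω = ιx∈Ω
    ... | inj₂ ιx∈o = contradiction x∈Ω (o#Ω (subst (_∈ o) (ι-involutive x) (clo ιx∈o)))
    from : Closed Ω → Closed (Ω ∪ o)
    from cl x∈ with x∈p∪q⁻ Ω o x∈
    ... | inj₁ x∈Ω = x∈p∪q⁺ (inj₁ (cl x∈Ω))
    ... | inj₂ x∈o = x∈p∪q⁺ (inj₂ (clo x∈o))

  ∪-⊆⇔ : o ⊆ S → Ω ∪ o ⊆ S ⇔ Ω ⊆ S
  ∪-⊆⇔ {o = o} {Ω = Ω} o⊆S =
    mk⇔ (λ Ω∪o⊆S {x} x∈Ω → Ω∪o⊆S (x∈p∪q⁺ (inj₁ x∈Ω)))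
        (λ Ω⊆S {x} x∈ → [ Ω⊆S , o⊆S ]′ (x∈p∪q⁻ Ω o x∈))

  closedIn-─⇔ : Disjoint o Ω → ClosedIn S Ω ⇔ ClosedIn (S ─ o) Ω
  closedIn-─⇔ o#Ω = ⊆⇔⊆─ o#Ω ×-⇔ ⇔-id _

  closedIn-∪⇔ : Closed o → o ⊆ S → Disjoint o Ω → ClosedIn S (Ω ∪ o) ⇔ ClosedIn (S ─ o) Ω
  closedIn-∪⇔ clo o⊆S o#Ω = (⊆⇔⊆─ o#Ω ⇔-∘ ∪-⊆⇔ o⊆S) ×-⇔ closed-∪⇔ clo o#Ω

  ¬closedIn-∪⁅x⁆ : ι x ≢ x → ι x ∉ Ω → ¬ ClosedIn S (Ω ∪ ⁅ x ⁆)
  ¬closedIn-∪⁅x⁆ {x = x} {Ω = Ω} ιx≢x ιx∉Ω (_ , cl) =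
    [ ιx∉Ω , ιx≢x ]′ (x∈p∪⁅y⁆⁻ Ω (cl (x∈p∪q⁺ (inj₂ (x∈⁅x⁆ x)))))

  ¬closedIn-∋ : x ∉ S → x ∈ Ω → ¬ ClosedIn S Ω
  ¬closedIn-∋ x∉S x∈Ω (Ω⊆S , _) = x∉S (Ω⊆S x∈Ω)

  orbit⊆ : g ∈ S → ι g ∈ S → orbit g ⊆ S
  orbit⊆ {g = g} g∈S ιg∈S x∈ = [ ⁅x⁆⊆p ιg∈S , ⁅x⁆⊆p g∈S ]′ (x∈p∪q⁻ ⁅ ι g ⁆ ⁅ g ⁆ x∈)

  orbit# : g ∉ Ω → ι g ∉ Ω → Disjoint (orbit g) Ω
  orbit# {g = g} g∉Ω ιg∉Ω x∈ = [ ⁅x⁆#p ιg∉Ω , ⁅x⁆#p g∉Ω ]′ (x∈p∪q⁻ ⁅ ι g ⁆ ⁅ g ⁆ x∈)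

  closedCount-0 : ∀ S → closedCount (λ _ → + 0) S ≡ + 0
  closedCount-0 S = ∑-0 {f = λ Ω → + 0 when closedIn? S Ω} (λ Ω → when-0 (closedIn? S Ω))

  closedCount-cong : ∀ {u v} S → (∀ j → u j ≡ v j) → closedCount u S ≡ closedCount v S
  closedCount-cong S u≗v = ∑-cong (λ Ω → cong (_when closedIn? S Ω) (u≗v ∣ Ω ∣))

  closedCount-+ : ∀ u v S → closedCount (λ j → u j + v j) S ≡ closedCount u S + closedCount v S
  closedCount-+ u v S = trans (∑-cong (λ Ω → when-+ (u ∣ Ω ∣) (v ∣ Ω ∣) (closedIn? S Ω)))
                              (sum-map-+ (λ Ω → u ∣ Ω ∣ when closedIn? S Ω) _ (allSubsets n))

  -- Shifting the weight δ k by one corresponds to multiplying by x.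
  closedCount-shift : ∀ m {p} → (∀ k → closedCount (λ j → δ k (m ℕ.+ j)) S ≡ coeff p k) →
                      ∀ k → closedCount (λ j → δ k (suc m ℕ.+ j)) S ≡ coeff (+ 0 ∷ p) k
  closedCount-shift {S = S} m hyp zero = closedCount-0 S
  closedCount-shift m hyp (suc k) = hyp k

  closedCount-fixed : g ∈ S → ι g ≡ g → ∀ w →
                      closedCount w S ≡ closedCount w (S - g) + closedCount (w ∘ suc) (S - g)
  closedCount-fixed {g = g} {S = S} g∈S ιg≡g w = begin
    ∑ f
      ≡⟨ ∑-insert g f ⟩
    ∑ (λ Ω → (f Ω + f (Ω ∪ ⁅ g ⁆)) when ¬? (g ∈? Ω))
      ≡⟨ ∑-cong split ⟩
    ∑ (λ Ω → w ∣ Ω ∣ when closedIn? S′ Ω + w (suc ∣ Ω ∣) when closedIn? S′ Ω)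
      ≡⟨ sum-map-+ (λ Ω → w ∣ Ω ∣ when closedIn? S′ Ω) _ (allSubsets n) ⟩
    closedCount w S′ + closedCount (w ∘ suc) S′ ∎
    where
    open ≡-Reasoning
    S′ = S - g
    f : Subset n → ℤ
    f Ω = w ∣ Ω ∣ when closedIn? S Ω
    split : ∀ Ω → (f Ω + f (Ω ∪ ⁅ g ⁆)) when ¬? (g ∈? Ω) ≡
                  w ∣ Ω ∣ when closedIn? S′ Ω + w (suc ∣ Ω ∣) when closedIn? S′ Ω
    split Ω with g ∈? Ω
    ... | yes g∈Ω =
      sym (cong₂ _+_ (when-no (w ∣ Ω ∣) (closedIn? S′ Ω) ¬cl)
                     (when-no (w (suc ∣ Ω ∣)) (closedIn? S′ Ω) ¬cl))
      where ¬cl = ¬closedIn-∋ x∉p-x g∈Ω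
    ... | no g∉Ω = cong₂ _+_
      (when-⇔ _ (closedIn? S Ω) (closedIn? S′ Ω) (closedIn-─⇔ (⁅x⁆#p g∉Ω)))
      (trans (cong (λ m → w m when closedIn? S (Ω ∪ ⁅ g ⁆)) (∣p∪⁅x⁆∣≡1+∣p∣ g∉Ω))
             (when-⇔ _ (closedIn? S (Ω ∪ ⁅ g ⁆)) (closedIn? S′ Ω)
                     (closedIn-∪⇔ (closed-⁅⁆ ιg≡g) (⁅x⁆⊆p g∈S) (⁅x⁆#p g∉Ω))))

  module _ {g S} (g∈S : g ∈ S) (ιg∈S : ι g ∈ S) (ιg≢g : ι g ≢ g) (w : ℕ → ℤ) where

    private
      S′ = S ─ orbit g

      f F X Y : Subset n → ℤ
      f Ω = w ∣ Ω ∣ when closedIn? S Ω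
      F Ω = (f Ω + f (Ω ∪ ⁅ g ⁆)) when ¬? (g ∈? Ω)
      X Ω = w ∣ Ω ∣ when closedIn? S′ Ω
      Y Ω = w (suc (suc ∣ Ω ∣)) when closedIn? S′ Ω

      meets-orbit : ∀ {x Ω} → x ∈ orbit g → x ∈ Ω → X Ω + Y Ω ≡ + 0
      meets-orbit {Ω = Ω} x∈orbit x∈Ω =
        cong₂ _+_ (when-no (w ∣ Ω ∣) (closedIn? S′ Ω) ¬cl)
                  (when-no (w (suc (suc ∣ Ω ∣))) (closedIn? S′ Ω) ¬cl)
        where ¬cl = ¬closedIn-∋ (λ x∈S′ → x∈p─q⇒x∉q x∈S′ x∈orbit) x∈Ω

      half-orbit : ∀ {x Ω} → ι x ≢ x → ι x ∉ Ω → f (Ω ∪ ⁅ x ⁆) ≡ + 0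
      half-orbit {x} {Ω} ιx≢x ιx∉Ω = when-no _ (closedIn? S (Ω ∪ ⁅ x ⁆)) (¬closedIn-∪⁅x⁆ ιx≢x ιx∉Ω)

      g∉Ω∪ιg : g ∉ Ω → g ∉ Ω ∪ ⁅ ι g ⁆
      g∉Ω∪ιg {Ω} g∉Ω g∈ = [ g∉Ω , ιg≢g ∘ sym ]′ (x∈p∪⁅y⁆⁻ Ω g∈)

      whole-orbit : g ∉ Ω → ι g ∉ Ω → f ((Ω ∪ ⁅ ι g ⁆) ∪ ⁅ g ⁆) ≡ Y Ω
      whole-orbit {Ω} g∉Ω ιg∉Ω = begin
        w ∣ (Ω ∪ ⁅ ι g ⁆) ∪ ⁅ g ⁆ ∣ when closedIn? S ((Ω ∪ ⁅ ι g ⁆) ∪ ⁅ g ⁆)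
          ≡⟨ cong (λ m → w m when closedIn? S ((Ω ∪ ⁅ ι g ⁆) ∪ ⁅ g ⁆)) size ⟩
        w (suc (suc ∣ Ω ∣)) when closedIn? S ((Ω ∪ ⁅ ι g ⁆) ∪ ⁅ g ⁆)
          ≡⟨ cong (λ Ω′ → w (suc (suc ∣ Ω ∣)) when closedIn? S Ω′) (∪-assoc Ω ⁅ ι g ⁆ ⁅ g ⁆) ⟩
        w (suc (suc ∣ Ω ∣)) when closedIn? S (Ω ∪ orbit g)
          ≡⟨ when-⇔ _ (closedIn? S (Ω ∪ orbit g)) (closedIn? S′ Ω)
                    (closedIn-∪⇔ (closed-orbit g) (orbit⊆ g∈S ιg∈S) (orbit# g∉Ω ιg∉Ω)) ⟩
        Y Ω ∎
        where
        open ≡-Reasoning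
        size : ∣ (Ω ∪ ⁅ ι g ⁆) ∪ ⁅ g ⁆ ∣ ≡ suc (suc ∣ Ω ∣)
        size = trans (∣p∪⁅x⁆∣≡1+∣p∣ (g∉Ω∪ιg g∉Ω)) (cong suc (∣p∪⁅x⁆∣≡1+∣p∣ ιg∉Ω))

      avoids-orbit : g ∉ Ω → ι g ∉ Ω → F Ω + F (Ω ∪ ⁅ ι g ⁆) ≡ X Ω + Y Ω
      avoids-orbit {Ω} g∉Ω ιg∉Ω = begin
        F Ω + F (Ω ∪ ⁅ ι g ⁆)
          ≡⟨ cong₂ _+_ (when-yes _ (¬? (g ∈? Ω)) g∉Ω)
                       (when-yes _ (¬? (g ∈? (Ω ∪ ⁅ ι g ⁆))) (g∉Ω∪ιg g∉Ω)) ⟩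
        (f Ω + f (Ω ∪ ⁅ g ⁆)) + (f (Ω ∪ ⁅ ι g ⁆) + f ((Ω ∪ ⁅ ι g ⁆) ∪ ⁅ g ⁆))
          ≡⟨ cong₂ _+_ (cong (_+_ (f Ω)) (half-orbit ιg≢g ιg∉Ω))
                       (cong (_+ f ((Ω ∪ ⁅ ι g ⁆) ∪ ⁅ g ⁆)) (half-orbit ιιg≢ιg ιιg∉Ω)) ⟩
        (f Ω + + 0) + (+ 0 + f ((Ω ∪ ⁅ ι g ⁆) ∪ ⁅ g ⁆))
          ≡⟨ cong₂ _+_ (ℤ.+-identityʳ (f Ω)) (ℤ.+-identityˡ _) ⟩
        f Ω + f ((Ω ∪ ⁅ ι g ⁆) ∪ ⁅ g ⁆)
          ≡⟨ cong₂ _+_ (when-⇔ _ (closedIn? S Ω) (closedIn? S′ Ω) (closedIn-─⇔ (orbit# g∉Ω ιg∉Ω)))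
                       (whole-orbit g∉Ω ιg∉Ω) ⟩
        X Ω + Y Ω ∎
        where
        open ≡-Reasoning
        ιιg≢ιg : ι (ι g) ≢ ι g
        ιιg≢ιg e = ιg≢g (trans (sym e) (ι-involutive g))
        ιιg∉Ω : ι (ι g) ∉ Ω
        ιιg∉Ω = subst (_∉ Ω) (sym (ι-involutive g)) g∉Ω

      meets-g : g ∈ Ω → F Ω + F (Ω ∪ ⁅ ι g ⁆) ≡ X Ω + Y Ω
      meets-g {Ω} g∈Ω = begin
        F Ω + F (Ω ∪ ⁅ ι g ⁆)
          ≡⟨ cong₂ _+_ (when-no _ (¬? (g ∈? Ω)) (λ g∉Ω → g∉Ω g∈Ω))
                       (when-no _ (¬? (g ∈? (Ω ∪ ⁅ ι g ⁆))) (λ g∉ → g∉ (x∈p∪q⁺ (inj₁ g∈Ω)))) ⟩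
        + 0
          ≡⟨ meets-orbit (x∈p∪q⁺ (inj₂ (x∈⁅x⁆ g))) g∈Ω ⟨
        X Ω + Y Ω ∎
        where open ≡-Reasoning

      split : ∀ Ω → (F Ω + F (Ω ∪ ⁅ ι g ⁆)) when ¬? (ι g ∈? Ω) ≡ X Ω + Y Ω
      split Ω with ι g ∈? Ω
      ... | yes ιg∈Ω = sym (meets-orbit (x∈p∪q⁺ (inj₁ (x∈⁅x⁆ (ι g)))) ιg∈Ω)
      ... | no ιg∉Ω = by-cases (g ∈? Ω)
        where
        by-cases : Dec (g ∈ Ω) → F Ω + F (Ω ∪ ⁅ ι g ⁆) ≡ X Ω + Y Ω
        by-cases (yes g∈Ω) = meets-g g∈Ω
        by-cases (no g∉Ω) = avoids-orbit g∉Ω ιg∉Ω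

    closedCount-pair : closedCount w S ≡ closedCount w S′ + closedCount (w ∘ suc ∘ suc) S′
    closedCount-pair = begin
      ∑ f                                                    ≡⟨ ∑-insert g f ⟩
      ∑ F                                                    ≡⟨ ∑-insert (ι g) F ⟩
      ∑ (λ Ω → (F Ω + F (Ω ∪ ⁅ ι g ⁆)) when ¬? (ι g ∈? Ω))   ≡⟨ ∑-cong split ⟩
      ∑ (λ Ω → X Ω + Y Ω)                                    ≡⟨ sum-map-+ X Y (allSubsets n) ⟩
      closedCount w S′ + closedCount (w ∘ suc ∘ suc) S′      ∎
      where open ≡-Reasoning

  closedCount-⊥-only : ∀ w S → (∀ Ω → Nonempty Ω → w ∣ Ω ∣ when closedIn? S Ω ≡ + 0) →
                       closedCount w S ≡ w 0
  closedCount-⊥-only w S vanishes = begin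
    closedCount w S                 ≡⟨ ∑-only-⊥ vanishes ⟩
    w ∣ ⊥ {n} ∣ when closedIn? S ⊥  ≡⟨ when-yes _ (closedIn? S ⊥) (⊥⊆ , λ x∈⊥ → contradiction x∈⊥ ∉⊥) ⟩
    w ∣ ⊥ {n} ∣                     ≡⟨ cong w (∣⊥∣≡0 n) ⟩
    w 0                             ∎
    where open ≡-Reasoning

  closedCount-⊥ : ∀ w → closedCount w ⊥ ≡ w 0
  closedCount-⊥ w = closedCount-⊥-only w ⊥
    (λ Ω (x , x∈Ω) → when-no _ (closedIn? ⊥ Ω) (λ (Ω⊆⊥ , _) → ∉⊥ (Ω⊆⊥ x∈Ω)))

  closedCount-δ0 : ∀ S → closedCount (δ 0) S ≡ + 1
  closedCount-δ0 S = closedCount-⊥-only (δ 0) S vanishes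
    where
    vanishes : ∀ Ω → Nonempty Ω → δ 0 ∣ Ω ∣ when closedIn? S Ω ≡ + 0
    vanishes Ω (x , x∈Ω) rewrite ∣p∣≡1+∣p-x∣ x∈Ω = when-0 (closedIn? S Ω)

  closedCount-1 : ∀ S → closedCount (λ _ → + 1) S ≡ + 1 + closedCount δ≥1 S
  closedCount-1 S = begin
    closedCount (λ _ → + 1) S               ≡⟨ closedCount-cong S empty-or-not ⟩
    closedCount (λ j → δ 0 j + δ≥1 j) S     ≡⟨ closedCount-+ (δ 0) δ≥1 S ⟩
    closedCount (δ 0) S + closedCount δ≥1 S ≡⟨ cong (_+ closedCount δ≥1 S) (closedCount-δ0 S) ⟩
    + 1 + closedCount δ≥1 S                 ∎
    where
    open ≡-Reasoning
    empty-or-not : ∀ j → + 1 ≡ δ 0 j + δ≥1 j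
    empty-or-not zero = refl
    empty-or-not (suc j) = refl

  fixedCount-fixed : g ∈ S → ι g ≡ g → fixedCount S ≡ suc (fixedCount (S - g))
  fixedCount-fixed {g = g} {S = S} g∈S ιg≡g =
    trans (∣p∣≡1+∣p-x∣ (∈⟦⟧⁺ (fixedIn? S) (g∈S , ιg≡g))) (cong (suc ∘ ∣_∣) (⊆-antisym to from))
    where
    fixedIn? : ∀ S → Decidable (λ x → x ∈ S × ι x ≡ x)
    fixedIn? S x = x ∈? S ×-dec ι x ≟ x
    to : ⟦ fixedIn? S ⟧ - g ⊆ ⟦ fixedIn? (S - g) ⟧
    to x∈ with ∈⟦⟧⁻ (fixedIn? S) (p─q⊆p _ ⁅ g ⁆ x∈)
    ... | x∈S , ιx≡x = ∈⟦⟧⁺ (fixedIn? (S - g)) (x∈p∧x≢y⇒x∈p-y x∈S (x∈p-y⇒x≢y x∈) , ιx≡x)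
    from : ⟦ fixedIn? (S - g) ⟧ ⊆ ⟦ fixedIn? S ⟧ - g
    from x∈ with ∈⟦⟧⁻ (fixedIn? (S - g)) x∈
    ... | x∈S-g , ιx≡x =
      x∈p∧x≢y⇒x∈p-y (∈⟦⟧⁺ (fixedIn? S) (p─q⊆p S ⁅ g ⁆ x∈S-g , ιx≡x)) (x∈p-y⇒x≢y x∈S-g)

  fixedCount-none : (∀ {x} → x ∈ S → ι x ≢ x) → fixedCount S ≡ 0
  fixedCount-none {S = S} no-fixed =
    trans (cong ∣_∣ (Empty-unique λ (_ , x∈) → uncurry no-fixed (∈⟦⟧⁻ (λ x → x ∈? S ×-dec ι x ≟ x) x∈)))
          (∣⊥∣≡0 n)

  size-pair : g ∈ S → ι g ∈ S → ι g ≢ g → ∣ S ∣ ≡ suc (suc ∣ S ─ orbit g ∣)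
  size-pair {g = g} {S = S} g∈S ιg∈S ιg≢g = begin
    ∣ S ∣                        ≡⟨ ∣p∣≡1+∣p-x∣ ιg∈S ⟩
    suc ∣ S - ι g ∣              ≡⟨ cong suc (∣p∣≡1+∣p-x∣ (x∈p∧x≢y⇒x∈p-y g∈S (ιg≢g ∘ sym))) ⟩
    suc (suc ∣ S - ι g - g ∣)    ≡⟨ cong (suc ∘ suc ∘ ∣_∣) (p─q─r≡p─q∪r S ⁅ ι g ⁆ ⁅ g ⁆) ⟩
    suc (suc ∣ S ─ orbit g ∣)    ∎
    where open ≡-Reasoning

  record OrbitCount (S : Subset n) (a b : ℕ) : Set where
    field
      size   : ∣ S ∣ ≡ 2 ℕ.* a ℕ.+ b
      coeffs : ∀ k → closedCount (δ k) S ≡ coeff (orbitPoly a b) k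
      total  : closedCount (λ _ → + 1) S ≡ + (2 ℕ.^ (a ℕ.+ b))

  private
    doubling : ∀ m → + (2 ℕ.^ m) + + (2 ℕ.^ m) ≡ + (2 ℕ.^ suc m)
    doubling m = cong (λ k → + (2 ℕ.^ m ℕ.+ k)) (sym (ℕ.+-identityʳ (2 ℕ.^ m)))

  orbitCount-⊥ : OrbitCount ⊥ 0 0
  orbitCount-⊥ = record
    { size = ∣⊥∣≡0 n
    ; coeffs = λ k → trans (closedCount-⊥ (δ k)) (sym (trans (*ₚ-identityʳ oneₚ k) (coeff-oneₚ k)))
    ; total = closedCount-⊥ (λ _ → + 1)
    }
    where
    coeff-oneₚ : ∀ k → coeff oneₚ k ≡ δ k 0
    coeff-oneₚ zero = refl
    coeff-oneₚ (suc k) = refl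

  orbitCount-fixed : ∀ {a b} → g ∈ S → ι g ≡ g → OrbitCount (S - g) a b → OrbitCount S a (suc b)
  orbitCount-fixed {g = g} {S = S} {a} {b} g∈S ιg≡g c = record
    { size = trans (∣p∣≡1+∣p-x∣ g∈S)
                   (trans (cong suc (OrbitCount.size c)) (sym (ℕ.+-suc (2 ℕ.* a) b)))
    ; coeffs = λ k → begin
        closedCount (δ k) S
          ≡⟨ closedCount-fixed g∈S ιg≡g (δ k) ⟩
        closedCount (δ k) (S - g) + closedCount (δ k ∘ suc) (S - g)
          ≡⟨ cong₂ _+_ (OrbitCount.coeffs c k) (closedCount-shift 0 (OrbitCount.coeffs c) k) ⟩
        coeff (orbitPoly a b) k + coeff (+ 0 ∷ orbitPoly a b) k
          ≡⟨ coeff-+ₚ (orbitPoly a b) _ k ⟨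
        coeff (orbitPoly a b +ₚ (+ 0 ∷ orbitPoly a b)) k
          ≡⟨ orbitPoly-fixed a b k ⟨
        coeff (orbitPoly a (suc b)) k ∎
    ; total = begin
        closedCount (λ _ → + 1) S
          ≡⟨ closedCount-fixed g∈S ιg≡g (λ _ → + 1) ⟩
        closedCount (λ _ → + 1) (S - g) + closedCount (λ _ → + 1) (S - g)
          ≡⟨ cong₂ _+_ (OrbitCount.total c) (OrbitCount.total c) ⟩
        + (2 ℕ.^ (a ℕ.+ b)) + + (2 ℕ.^ (a ℕ.+ b))
          ≡⟨ doubling (a ℕ.+ b) ⟩
        + (2 ℕ.^ suc (a ℕ.+ b))
          ≡⟨ cong (λ m → + (2 ℕ.^ m)) (ℕ.+-suc a b) ⟨
        + (2 ℕ.^ (a ℕ.+ suc b)) ∎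
    }
    where open ≡-Reasoning

  orbitCount-pair : ∀ {a} → g ∈ S → ι g ∈ S → ι g ≢ g →
                    OrbitCount (S ─ orbit g) a 0 → OrbitCount S (suc a) 0
  orbitCount-pair {g = g} {S = S} {a} g∈S ιg∈S ιg≢g c = record
    { size = trans (size-pair g∈S ιg∈S ιg≢g) (trans (cong (suc ∘ suc) (OrbitCount.size c)) (arith a))
    ; coeffs = λ k → begin
        closedCount (δ k) S
          ≡⟨ closedCount-pair g∈S ιg∈S ιg≢g (δ k) ⟩
        closedCount (δ k) S′ + closedCount (δ k ∘ suc ∘ suc) S′
          ≡⟨ cong₂ _+_ (OrbitCount.coeffs c k)
                       (closedCount-shift 1 (closedCount-shift 0 (OrbitCount.coeffs c)) k) ⟩
        coeff (orbitPoly a 0) k + coeff (+ 0 ∷ + 0 ∷ orbitPoly a 0) k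
          ≡⟨ coeff-+ₚ (orbitPoly a 0) _ k ⟨
        coeff (orbitPoly a 0 +ₚ (+ 0 ∷ + 0 ∷ orbitPoly a 0)) k
          ≡⟨ orbitPoly-pair a k ⟨
        coeff (orbitPoly (suc a) 0) k ∎
    ; total = trans (closedCount-pair g∈S ιg∈S ιg≢g (λ _ → + 1))
                    (trans (cong₂ _+_ (OrbitCount.total c) (OrbitCount.total c)) (doubling (a ℕ.+ 0)))
    }
    where
    open ≡-Reasoning
    S′ = S ─ orbit g
    arith : ∀ a → suc (suc (2 ℕ.* a ℕ.+ 0)) ≡ 2 ℕ.* suc a ℕ.+ 0
    arith = ℕ-solve-∀

  orbitCount : ∀ S → Closed S → Σ ℕ λ a → OrbitCount S a (fixedCount S)
  orbitCount = All.wfRec (On.wellFounded ∣_∣ <-wellFounded) 0ℓ Goal step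
    where
    Goal : Subset n → Set
    Goal S = Closed S → Σ ℕ λ a → OrbitCount S a (fixedCount S)

    step : ∀ S → (∀ {T} → ∣ T ∣ < ∣ S ∣ → Goal T) → Goal S
    step S rec clS with any? (λ x → x ∈? S ×-dec ι x ≟ x)
    ... | yes (g , g∈S , ιg≡g) =
      let a , c = rec (x∈p⇒∣p-x∣<∣p∣ g∈S) (closed-─ clS (closed-⁅⁆ ιg≡g))
      in a , subst (OrbitCount S a) (sym (fixedCount-fixed g∈S ιg≡g)) (orbitCount-fixed g∈S ιg≡g c)
    ... | no ∄fixed with nonempty? S
    ...   | yes (g , g∈S) =
      let a , c = rec S′<S (closed-─ clS (closed-orbit g))
          c′ = subst (OrbitCount S′ a)
                     (fixedCount-none (λ x∈S′ → no-fixed (p─q⊆p S (orbit g) x∈S′))) c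
      in suc a , subst (OrbitCount S (suc a)) (sym (fixedCount-none no-fixed))
                       (orbitCount-pair g∈S (clS g∈S) (no-fixed g∈S) c′)
      where
      S′ = S ─ orbit g
      no-fixed : ∀ {x} → x ∈ S → ι x ≢ x
      no-fixed x∈S ιx≡x = ∄fixed (_ , x∈S , ιx≡x)
      S′<S : ∣ S′ ∣ < ∣ S ∣
      S′<S = subst (∣ S′ ∣ <_) (sym (size-pair g∈S (clS g∈S) (no-fixed g∈S)))
                   (ℕ.m<n⇒m<1+n (ℕ.n<1+n _))
    ...   | no empty rewrite Empty-unique empty =
      0 , subst (OrbitCount ⊥ 0) (sym (fixedCount-none (λ x∈⊥ → contradiction x∈⊥ ∉⊥))) orbitCount-⊥

-- Subgroups of a finite abelian group and the Möbius inversion over them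

module Subgroups {n : ℕ} (G : FinAbGroup n) where
  open FinAbGroup G

  private
    variable
      K Ω : Subset n
      Ks : List (Subset n)

  subgroups-IsSubgroup : All (IsSubgroup G) (subgroups G)
  subgroups-IsSubgroup = All.all-filter (isSubgroup? G) (allSubsets n)

  ∈-subgroups : IsSubgroup G K → K ∈ₗ subgroups G
  ∈-subgroups {K = K} K≤G = ∈-filter⁺ (isSubgroup? G) (∈-allSubsets K) K≤G

  ⋂-IsSubgroup : All (IsSubgroup G) Ks → IsSubgroup G (⋂ Ks)
  ⋂-IsSubgroup [] = ∈⊤ , (λ _ _ _ _ → ∈⊤) , (λ _ _ → ∈⊤)
  ⋂-IsSubgroup {Ks = K ∷ Ks} ((ε∈K , ∙∈K , ⁻¹∈K) ∷ Ks≤G) with ⋂-IsSubgroup Ks≤G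
  ... | ε∈⋂ , ∙∈⋂ , ⁻¹∈⋂ =
      x∈p∩q⁺ (ε∈K , ε∈⋂)
    , (λ x y x∈ y∈ → let x∈K , x∈⋂ = x∈p∩q⁻ K (⋂ Ks) x∈ ; y∈K , y∈⋂ = x∈p∩q⁻ K (⋂ Ks) y∈
                     in x∈p∩q⁺ (∙∈K x y x∈K y∈K , ∙∈⋂ x y x∈⋂ y∈⋂))
    , (λ x x∈ → let x∈K , x∈⋂ = x∈p∩q⁻ K (⋂ Ks) x∈ in x∈p∩q⁺ (⁻¹∈K x x∈K , ⁻¹∈⋂ x x∈⋂))

  ⊆-⋂ : All (Ω ⊆_) Ks → Ω ⊆ ⋂ Ks
  ⊆-⋂ [] _ = ∈⊤
  ⊆-⋂ (Ω⊆K ∷ Ω⊆Ks) x∈Ω = x∈p∩q⁺ (Ω⊆K x∈Ω , ⊆-⋂ Ω⊆Ks x∈Ω)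

  ⋂-⊆ : K ∈ₗ Ks → ⋂ Ks ⊆ K
  ⋂-⊆ {Ks = K′ ∷ Ks} (here refl) x∈ = proj₁ (x∈p∩q⁻ K′ (⋂ Ks) x∈)
  ⋂-⊆ {Ks = K′ ∷ Ks} (there K∈Ks) x∈ = ⋂-⊆ K∈Ks (proj₂ (x∈p∩q⁻ K′ (⋂ Ks) x∈))

  ⟨_⟩ : Subset n → Subset n
  ⟨ Ω ⟩ = ⋂ (filter (Ω ⊆?_) (subgroups G))

  ⟨⟩-IsSubgroup : ∀ Ω → IsSubgroup G ⟨ Ω ⟩
  ⟨⟩-IsSubgroup Ω = ⋂-IsSubgroup (All.filter⁺ (Ω ⊆?_) subgroups-IsSubgroup)

  ⊆⟨⟩ : ∀ Ω → Ω ⊆ ⟨ Ω ⟩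
  ⊆⟨⟩ Ω = ⊆-⋂ (All.all-filter (Ω ⊆?_) (subgroups G))

  ⟨⟩-least : IsSubgroup G K → Ω ⊆ K → ⟨ Ω ⟩ ⊆ K
  ⟨⟩-least {K = K} {Ω = Ω} K≤G Ω⊆K = ⋂-⊆ (∈-filter⁺ (Ω ⊆?_) (∈-subgroups K≤G) Ω⊆K)

  full⇔generates : ∀ Ω → (∀ x → x ∈ ⟨ Ω ⟩) ⇔ Generates G Ω
  full⇔generates Ω = mk⇔ generates (λ gen → gen ⟨ Ω ⟩ (⟨⟩-IsSubgroup Ω) (⊆⟨⟩ Ω))
    where
    generates : (∀ x → x ∈ ⟨ Ω ⟩) → Generates G Ω
    generates full K K≤G Ω⊆K x = ⟨⟩-least K≤G Ω⊆K (full x)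

  generates? : Decidable (Generates G)
  generates? Ω = Dec.map (full⇔generates Ω) (all? (_∈? ⟨ Ω ⟩))

  module _ (μ : Subset n → ℤ) (μ-Möbius : IsMöbius G μ) where

    -- Möbius inversion: Σ_{K ⊇ Ω} μ(K) = Σ_{K ⊇ ⟨Ω⟩} μ(K), which is 1 iff ⟨Ω⟩ is everything.
    sum-μ-over-⊇ : ∀ Ω → sumℤ (map (λ K → μ K when (Ω ⊆? K)) (subgroups G)) ≡
                         + 1 when generates? Ω
    sum-μ-over-⊇ Ω = begin
      sumℤ (map (λ K → μ K when (Ω ⊆? K)) (subgroups G))
        ≡⟨ sum-map-cong (λ K≤G → when-⇔ _ (Ω ⊆? _) (⟨ Ω ⟩ ⊆? _)
                                        (mk⇔ (⟨⟩-least K≤G) (λ ⟨Ω⟩⊆K → ⟨Ω⟩⊆K ∘ ⊆⟨⟩ Ω)))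
                        subgroups-IsSubgroup ⟩
      sumℤ (map (λ K → μ K when (⟨ Ω ⟩ ⊆? K)) (subgroups G))
        ≡⟨ sum-map-when (⟨ Ω ⟩ ⊆?_) μ (subgroups G) ⟩
      sumℤ (map μ (filter (⟨ Ω ⟩ ⊆?_) (subgroups G)))
        ≡⟨ by-cases (all? (_∈? ⟨ Ω ⟩)) ⟩
      + 1 when generates? Ω ∎
      where
      open ≡-Reasoning
      by-cases : Dec (∀ x → x ∈ ⟨ Ω ⟩) →
                 sumℤ (map μ (filter (⟨ Ω ⟩ ⊆?_) (subgroups G))) ≡ + 1 when generates? Ω
      by-cases (yes full) = trans (proj₁ (μ-Möbius ⟨ Ω ⟩ (⟨⟩-IsSubgroup Ω)) full)
                                  (sym (when-yes _ (generates? Ω) (Equivalence.to (full⇔generates Ω) full)))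
      by-cases (no ¬full) = trans (proj₂ (μ-Möbius ⟨ Ω ⟩ (⟨⟩-IsSubgroup Ω)) ¬full)
                                  (sym (when-no _ (generates? Ω) (¬full ∘ Equivalence.from (full⇔generates Ω))))

    ∑-generating : ∀ (F : Subset n → ℤ) →
                   ∑ (λ Ω → F Ω when generates? Ω) ≡
                   sumℤ (map (λ K → μ K * ∑ (λ Ω → F Ω when (Ω ⊆? K))) (subgroups G))
    ∑-generating F = begin
      ∑ (λ Ω → F Ω when generates? Ω)
        ≡⟨ ∑-cong (λ Ω → when-as-* (F Ω) (generates? Ω)) ⟩
      ∑ (λ Ω → F Ω * (+ 1 when generates? Ω))
        ≡⟨ ∑-cong (λ Ω → cong (F Ω *_) (sym (sum-μ-over-⊇ Ω))) ⟩
      ∑ (λ Ω → F Ω * sumℤ (map (λ K → μ K when (Ω ⊆? K)) (subgroups G)))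
        ≡⟨ ∑-cong (λ Ω → trans (sym (sum-map-*ˡ (F Ω) _ (subgroups G)))
                               (cong sumℤ (List.map-cong (λ K → *-when-swap (F Ω) (μ K) (Ω ⊆? K)) (subgroups G)))) ⟩
      ∑ (λ Ω → sumℤ (map (λ K → μ K * (F Ω when (Ω ⊆? K))) (subgroups G)))
        ≡⟨ sym (sum-map-swap (λ K Ω → μ K * (F Ω when (Ω ⊆? K))) (subgroups G) (allSubsets n)) ⟩
      sumℤ (map (λ K → ∑ (λ Ω → μ K * (F Ω when (Ω ⊆? K)))) (subgroups G))
        ≡⟨ cong sumℤ (List.map-cong (λ K → sum-map-*ˡ (μ K) _ (allSubsets n)) (subgroups G)) ⟩
      sumℤ (map (λ K → μ K * ∑ (λ Ω → F Ω when (Ω ⊆? K))) (subgroups G)) ∎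
      where open ≡-Reasoning

-- Cayley graphs of a finite abelian group

module CayleyGraphs {n : ℕ} (G : FinAbGroup n) where
  open FinAbGroup G
  open IsAbelianGroup isAbelianGroup using (assoc; comm; identityˡ; identityʳ; inverseˡ; inverseʳ; isGroup)
  open Subgroups G

  private
    variable
      K Ω Ω′ : Subset n

    group : Group 0ℓ 0ℓ
    group = record { isGroup = isGroup }

  open GroupProperties group using (⁻¹-involutive; ε⁻¹≈ε; inverseʳ-unique)
  open ClosedSubsets _⁻¹ ⁻¹-involutive

  equivalent-refl : ∀ Ω → Equivalent G Ω Ω
  equivalent-refl Ω = ⤖-id (Fin n) , (λ _ _ → id , id) , (λ _ _ → refl)

  -- An equivalence commutes with translations, so it is the translation u ↦ u ∙ c by c = F ε
  -- (here commutativity is used); adjacency of ε and x then says x ∈ Ω ⇔ x ∈ Ω′.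
  equivalent⇒≡ : Equivalent G Ω Ω′ → Ω ≡ Ω′
  equivalent⇒≡ {Ω} {Ω′} (f , adjacency , equivariant) =
    ⊆-antisym
      (λ {x} x∈Ω → subst (_∈ Ω′) (c⁻¹∙Fx≡x x) (proj₁ (adjacency ε x) (subst (_∈ Ω) (sym (ε⁻¹∙x≡x x)) x∈Ω)))
      (λ {x} x∈Ω′ → subst (_∈ Ω) (ε⁻¹∙x≡x x) (proj₂ (adjacency ε x) (subst (_∈ Ω′) (sym (c⁻¹∙Fx≡x x)) x∈Ω′)))
    where
    F = Bijection.to f
    c = F ε
    c⁻¹∙Fx≡x : ∀ x → c ⁻¹ ∙ F x ≡ x
    c⁻¹∙Fx≡x x = begin
      c ⁻¹ ∙ F x          ≡⟨ cong (λ y → c ⁻¹ ∙ F y) (identityʳ x) ⟨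
      c ⁻¹ ∙ F (x ∙ ε)    ≡⟨ cong (c ⁻¹ ∙_) (trans (equivariant x ε) (comm x c)) ⟩
      c ⁻¹ ∙ (c ∙ x)      ≡⟨ assoc (c ⁻¹) c x ⟨
      c ⁻¹ ∙ c ∙ x        ≡⟨ cong (_∙ x) (inverseˡ c) ⟩
      ε ∙ x               ≡⟨ identityˡ x ⟩
      x                   ∎
      where open ≡-Reasoning
    ε⁻¹∙x≡x : ∀ x → ε ⁻¹ ∙ x ≡ x
    ε⁻¹∙x≡x x = trans (cong (_∙ x) ε⁻¹≈ε) (identityˡ x)

  numClasses : ∀ {P : Pred (Subset n) 0ℓ} (P? : Decidable P) →
               NumClasses G P (length (filter P? (allSubsets n)))
  numClasses P? =
      filter P? (allSubsets n)
    , refl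
    , All.all-filter P? (allSubsets n)
    , AllPairs.filter⁺ P? (AllPairs.map (λ Ω≢Ω′ → Ω≢Ω′ ∘ equivalent⇒≡) (allSubsets-unique n))
    , λ Ω PΩ → Any.map (λ Ω≡Ω′ → subst (Equivalent G Ω) Ω≡Ω′ (equivalent-refl Ω))
                       (∈-filter⁺ P? (∈-allSubsets Ω) PΩ)

  Symmetric : Pred (Subset n) 0ℓ
  Symmetric Ω = ∀ x → x ∈ Ω → x ⁻¹ ∈ Ω

  symmetric? : Decidable Symmetric
  symmetric? Ω = all? (λ x → x ∈? Ω →-dec x ⁻¹ ∈? Ω)

  isCayleySet? : Decidable (IsCayleySet G)
  isCayleySet? Ω = Dec.map′ (λ (gen , symm , ε∉) → symm , ε∉ , gen)
                            (λ (symm , ε∉ , gen) → gen , symm , ε∉)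
                            (generates? Ω ×-dec symmetric? Ω ×-dec ¬? (ε ∈? Ω))

  cayleyCount : (ℕ → ℤ) → ℤ
  cayleyCount w = ∑ λ Ω → w ∣ Ω ∣ when isCayleySet? Ω

  count-by-size : ∀ {P : Pred ℕ 0ℓ} (P? : Decidable P) →
                  + length (filter (λ Ω → isCayleySet? Ω ×-dec P? ∣ Ω ∣) (allSubsets n)) ≡
                  cayleyCount (λ j → + 1 when P? j)
  count-by-size P? = trans (length-filter≡sum _ (allSubsets n))
                           (∑-cong (λ Ω → when-×-dec (+ 1) (isCayleySet? Ω) (P? ∣ Ω ∣)))

  size<n : ε ∉ Ω → ∣ Ω ∣ < n
  size<n {Ω = Ω} ε∉Ω = subst (∣ Ω ∣ <_) (∣⊤∣≡n n) (p⊂q⇒∣p∣<∣q∣ (⊆⊤ , ε , ∈⊤ , ε∉Ω))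

  cayleyCount-δ-large : ∀ {k} → n ≤ k → cayleyCount (δ k) ≡ + 0
  cayleyCount-δ-large {k} n≤k = ∑-0 {f = λ Ω → δ k ∣ Ω ∣ when isCayleySet? Ω} vanishes
    where
    vanishes : ∀ Ω → δ k ∣ Ω ∣ when isCayleySet? Ω ≡ + 0
    vanishes Ω = when-vanishes _ (isCayleySet? Ω) λ (_ , ε∉Ω , _) →
      when-no (+ 1) (∣ Ω ∣ ℕ.≟ k) (ℕ.<⇒≢ (ℕ.<-≤-trans (size<n ε∉Ω) n≤k))

  closed-nonidentity : IsSubgroup G K → Closed (K - ε)
  closed-nonidentity {K} (_ , _ , ⁻¹∈K) {x} x∈K-ε =
    x∈p∧x≢y⇒x∈p-y (⁻¹∈K x (p─q⊆p K ⁅ ε ⁆ x∈K-ε))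
                  (λ x⁻¹≡ε → x∈p-y⇒x≢y x∈K-ε
                               (trans (sym (⁻¹-involutive x)) (trans (cong _⁻¹ x⁻¹≡ε) ε⁻¹≈ε)))

  connectionSet⇔closedIn : (Ω ⊆ K × Symmetric Ω × ε ∉ Ω) ⇔ ClosedIn (K - ε) Ω
  connectionSet⇔closedIn {Ω} {K} = mk⇔
    (λ (Ω⊆K , symm , ε∉Ω) → Equivalence.to (⊆⇔⊆─ (⁅x⁆#p ε∉Ω)) Ω⊆K , λ {x} → symm x)
    (λ (Ω⊆K-ε , cl) → p─q⊆p K ⁅ ε ⁆ ∘ Ω⊆K-ε , (λ _ → cl) , x∉p-x ∘ Ω⊆K-ε)

  O₂size≡fixedCount : ∀ K → O₂size G K ≡ fixedCount (K - ε)
  O₂size≡fixedCount K =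
    trans (length-filter-tabulate O₂? id)
          (cong ∣_∣ (⟦⟧-cong O₂? (λ x → x ∈? K - ε ×-dec x ⁻¹ ≟ x) involution⇔))
    where
    O₂? : Decidable (λ x → x ∈ K × x ∙ x ≡ ε × x ≢ ε)
    O₂? x = x ∈? K ×-dec x ∙ x ≟ ε ×-dec ¬? (x ≟ ε)
    involution⇔ : ∀ x → (x ∈ K × x ∙ x ≡ ε × x ≢ ε) ⇔ (x ∈ K - ε × x ⁻¹ ≡ x)
    involution⇔ x = mk⇔
      (λ (x∈K , x∙x≡ε , x≢ε) → x∈p∧x≢y⇒x∈p-y x∈K x≢ε , sym (inverseʳ-unique x x x∙x≡ε))
      (λ (x∈K-ε , x⁻¹≡x) →
        p─q⊆p K ⁅ ε ⁆ x∈K-ε , trans (cong (x ∙_) (sym x⁻¹≡x)) (inverseʳ x) , x∈p-y⇒x≢y x∈K-ε)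

  exponents : ∀ a b → (suc (2 ℕ.* a ℕ.+ b) ∸ b ∸ 1) ℕ./ 2 ≡ a
                    × (suc (2 ℕ.* a ℕ.+ b) ℕ.+ b ∸ 1) ℕ./ 2 ≡ a ℕ.+ b
  exponents a b =
      trans (cong (λ m → (m ∸ 1) ℕ./ 2) (ℕ.m+n∸n≡m (suc (2 ℕ.* a)) b)) (half a)
    , trans (cong (ℕ._/ 2) (double-sum a b)) (half (a ℕ.+ b))
    where
    half : ∀ m → 2 ℕ.* m ℕ./ 2 ≡ m
    half m = trans (cong (ℕ._/ 2) (ℕ.*-comm 2 m)) (m*n/n≡m m 2)
    double-sum : ∀ a b → 2 ℕ.* a ℕ.+ b ℕ.+ b ≡ 2 ℕ.* (a ℕ.+ b)
    double-sum = ℕ-solve-∀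

  subgroupPoly : Subset n → Poly
  subgroupPoly K = orbitPoly ((∣ K ∣ ∸ O₂size G K ∸ 1) ℕ./ 2) (O₂size G K)

  subgroupFormula : IsSubgroup G K →
    (∀ k → coeff (subgroupPoly K) k ≡ closedCount (δ k) (K - ε))
    × (+ (2 ℕ.^ ((∣ K ∣ ℕ.+ O₂size G K ∸ 1) ℕ./ 2)) ≡ closedCount (λ _ → + 1) (K - ε))
  subgroupFormula {K} K≤G with orbitCount (K - ε) (closed-nonidentity K≤G)
  ... | a , c
    rewrite ∣p∣≡1+∣p-x∣ (proj₁ K≤G) | OrbitCount.size c | sym (O₂size≡fixedCount K)
          | proj₁ (exponents a (O₂size G K)) | proj₂ (exponents a (O₂size G K))
    = (λ k → sym (OrbitCount.coeffs c k)) , sym (OrbitCount.total c)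

  module _ (μ : Subset n → ℤ) (μ-Möbius : IsMöbius G μ) where

    cayleyCount-Möbius : ∀ w → cayleyCount w ≡
                               sumℤ (map (λ K → μ K * closedCount w (K - ε)) (subgroups G))
    cayleyCount-Möbius w = begin
      cayleyCount w
        ≡⟨ ∑-cong (λ Ω → when-×-dec (w ∣ Ω ∣) (generates? Ω) (base? Ω)) ⟩
      ∑ (λ Ω → w ∣ Ω ∣ when base? Ω when generates? Ω)
        ≡⟨ ∑-generating μ μ-Möbius _ ⟩
      sumℤ (map (λ K → μ K * ∑ (λ Ω → w ∣ Ω ∣ when base? Ω when (Ω ⊆? K))) (subgroups G))
        ≡⟨ cong sumℤ (List.map-cong (λ K → cong (μ K *_) (∑-cong (restrict K))) (subgroups G)) ⟩
      sumℤ (map (λ K → μ K * closedCount w (K - ε)) (subgroups G)) ∎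
      where
      open ≡-Reasoning
      base? : Decidable (λ Ω → Symmetric Ω × ε ∉ Ω)
      base? Ω = symmetric? Ω ×-dec ¬? (ε ∈? Ω)
      restrict : ∀ K Ω → w ∣ Ω ∣ when base? Ω when (Ω ⊆? K) ≡ w ∣ Ω ∣ when closedIn? (K - ε) Ω
      restrict K Ω = trans (sym (when-×-dec (w ∣ Ω ∣) (Ω ⊆? K) (base? Ω)))
                           (when-⇔ _ (Ω ⊆? K ×-dec base? Ω) (closedIn? (K - ε) Ω) connectionSet⇔closedIn)

    coeff-ΨFormula : ∀ k → coeff (ΨFormula G μ) k ≡
      sumℤ (map (λ K → μ K * (coeff (subgroupPoly K) k + ℤ.- + 1 * coeff oneₚ k)) (subgroups G))
    coeff-ΨFormula k =
      trans (coeff-sumₚ term (subgroups G) k) (cong sumℤ (List.map-cong coeff-term (subgroups G)))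
      where
      term : Subset n → Poly
      term K = scaleₚ (μ K) (subgroupPoly K +ₚ scaleₚ (ℤ.- + 1) oneₚ)
      coeff-term : ∀ K → coeff (term K) k ≡ μ K * (coeff (subgroupPoly K) k + ℤ.- + 1 * coeff oneₚ k)
      coeff-term K = trans (coeff-scaleₚ (μ K) (subgroupPoly K +ₚ scaleₚ (ℤ.- + 1) oneₚ) k)
        (cong (μ K *_) (trans (coeff-+ₚ (subgroupPoly K) (scaleₚ (ℤ.- + 1) oneₚ) k)
                              (cong (_+_ (coeff (subgroupPoly K) k)) (coeff-scaleₚ (ℤ.- + 1) oneₚ k))))

    coeff-Ψ-0 : coeff (ΨFormula G μ) 0 ≡ + 0
    coeff-Ψ-0 = trans (coeff-ΨFormula 0)
                      (trans (sum-map-cong {g = λ _ → + 0} term-vanishes subgroups-IsSubgroup)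
                             (sum-map-0 (subgroups G)))
      where
      term-vanishes : IsSubgroup G K → μ K * (coeff (subgroupPoly K) 0 + ℤ.- + 1 * + 1) ≡ + 0
      term-vanishes {K} K≤G = trans (cong (λ c → μ K * (c + ℤ.- + 1 * + 1))
                                          (trans (proj₁ (subgroupFormula K≤G) 0) (closedCount-δ0 (K - ε))))
                                    (ℤ.*-zeroʳ (μ K))

    coeff-Ψ-suc : ∀ k → coeff (ΨFormula G μ) (suc k) ≡ cayleyCount (δ (suc k))
    coeff-Ψ-suc k = trans (coeff-ΨFormula (suc k))
      (trans (sum-map-cong term≡ subgroups-IsSubgroup)
             (sym (cayleyCount-Möbius (δ (suc k)))))
      where
      term≡ : IsSubgroup G K → μ K * (coeff (subgroupPoly K) (suc k) + ℤ.- + 1 * + 0) ≡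
                               μ K * closedCount (δ (suc k)) (K - ε)
      term≡ {K} K≤G = cong (μ K *_) (trans (ℤ.+-identityʳ _) (proj₁ (subgroupFormula K≤G) (suc k)))

    EFormula≡cayleyCount : EFormula G μ ≡ cayleyCount δ≥1
    EFormula≡cayleyCount =
      trans (sum-map-cong (λ {K} K≤G → cong (μ K *_) (term≡ K≤G)) subgroups-IsSubgroup)
            (sym (cayleyCount-Möbius δ≥1))
      where
      cancel : ∀ x → (+ 1 + x) ℤ.- + 1 ≡ x
      cancel = solve-∀
      term≡ : IsSubgroup G K → + (2 ℕ.^ ((∣ K ∣ ℕ.+ O₂size G K ∸ 1) ℕ./ 2)) ℤ.- + 1 ≡ closedCount δ≥1 (K - ε)
      term≡ {K} K≤G =
        trans (cong (ℤ._- + 1) (trans (proj₂ (subgroupFormula K≤G)) (closedCount-1 (K - ε)))) (cancel _)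

theorem3p1 : ∀ {n : ℕ} (G : FinAbGroup n) (μ : Subset n → ℤ) → IsMöbius G μ →
    (∀ k →
        (1 ≤ k → k < n → Σ ℕ λ m → IsAk G k m × (+ m ≡ coeff (ΨFormula G μ) k))
      × ((k ≡ 0 ⊎ n ≤ k) → coeff (ΨFormula G μ) k ≡ + 0))
    × (Σ ℕ λ m → IsE G m × (+ m ≡ EFormula G μ))
theorem3p1 {n} G μ μ-Möbius = (λ k → aₖ k , Ψ-vanishes k) , classes
  where
  open CayleyGraphs G

  aₖ : ∀ k → 1 ≤ k → k < n → Σ ℕ λ m → IsAk G k m × (+ m ≡ coeff (ΨFormula G μ) k)
  aₖ (suc k) _ _ = _ , numClasses (λ Ω → isCayleySet? Ω ×-dec ∣ Ω ∣ ℕ.≟ suc k)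
                     , trans (count-by-size (ℕ._≟ suc k)) (sym (coeff-Ψ-suc μ μ-Möbius k))

  Ψ-vanishes : ∀ k → k ≡ 0 ⊎ n ≤ k → coeff (ΨFormula G μ) k ≡ + 0
  Ψ-vanishes zero _ = coeff-Ψ-0 μ μ-Möbius
  Ψ-vanishes (suc k) (inj₂ n≤k) = trans (coeff-Ψ-suc μ μ-Möbius k) (cayleyCount-δ-large n≤k)

  classes : Σ ℕ λ m → IsE G m × (+ m ≡ EFormula G μ)
  classes = _ , numClasses (λ Ω → isCayleySet? Ω ×-dec 1 ℕ.≤? ∣ Ω ∣)
              , trans (count-by-size (1 ℕ.≤?_)) (sym (EFormula≡cayleyCount μ μ-Möbius))
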